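{- Let $T \in \mathscr{T}_{max}$ with $n = |V(T)| \ge 3$, and let $v \in V(T)$. Then $T - \{v\} \in \mathscr{T}_{max}$ if and only if either $v$ is a leaf whose support vertex is adjacent to at least one other leaf, or $v$ is a leaf whose support vertex has degree 2.
   Context: A leaf is a vertex of degree 1; a support vertex is a vertex adjacent to a leaf. $N(v)$ denotes the open neighborhood of $v$. A set $S \subseteq V(G)$ is a locating-dominating (LD) set if for all $u,v \in V(G)-S$: $N(v)\cap S \neq \varnothing$, and if $u \ne v$ then $N(v) \cap S \neq N(u) \cap S$. A RED:LD set is an LD set $S$ such that $S-\{v\}$ is an LD set for every $v \in S$. $\textrm{RED:LD}(G)$ is the minimum cardinality of a RED:LD set of $G$. $\mathscr{T}_{max}$ is the family of all trees $T$ of order $n \ge 2$ with $\textrm{RED:LD}(T) = n$ (a graph that is not a tree is not in $\mathscr{T}_{max}$). -}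

module Defs where

open import Data.Nat using (ℕ; suc; _≤_; _<_; _≥_)
open import Data.Bool using (Bool; T)
open import Data.Fin using (Fin; punchIn)
open import Data.Fin.Subset using (Subset; _∈_; _∉_; ∣_∣; _─_; ⁅_⁆)
open import Data.Vec using (tabulate)
open import Data.List using (List; _∷_; []; _++_; length)
open import Data.List.Relation.Unary.Linked using (Linked)
open import Data.List.Relation.Unary.Unique.Propositional using (Unique)
open import Data.Product using (Σ; ∃; ∃-syntax; _×_)
open import Relation.Binary.PropositionalEquality using (_≡_; _≢_)
open import Relation.Binary.Construct.Closure.ReflexiveTransitive using (Star)
open import Relation.Nullary using (¬_)
open import Function.Bundles using (_⇔_)

record Graph (n : ℕ) : Set where
  field
    adj   : Fin n → Fin n → Bool
    sym   : ∀ u v → adj u v ≡ adj v u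
    irref : ∀ v → adj v v ≡ Data.Bool.false

open Graph public

module _ {n : ℕ} (G : Graph n) where

  Adj : Fin n → Fin n → Set
  Adj u v = T (adj G u v)

  N : Fin n → Subset n
  N v = tabulate (adj G v)

  degree : Fin n → ℕ
  degree v = ∣ N v ∣

  IsLeaf : Fin n → Set
  IsLeaf v = degree v ≡ 1

  Connected : Set
  Connected = ∀ u v → Star Adj u v

  IsCycle : List (Fin n) → Set
  IsCycle [] = Data.Empty.⊥
    where import Data.Empty
  IsCycle (x ∷ xs) = (3 ≤ length (x ∷ xs)) × Unique (x ∷ xs) × Linked Adj ((x ∷ xs) ++ (x ∷ []))

  Acyclic : Set
  Acyclic = ∀ (c : List (Fin n)) → ¬ IsCycle c

  IsTree : Set
  IsTree = Connected × Acyclic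

  IsLD : Subset n → Set
  IsLD S = ∀ u v → u ∉ S → v ∉ S →
             (∃[ w ] (w ∈ S × Adj v w)) ×
             (u ≢ v → ¬ (∀ w → w ∈ S → (Adj v w ⇔ Adj u w)))

  IsRedLD : Subset n → Set
  IsRedLD S = IsLD S × (∀ v → v ∈ S → IsLD (S ─ ⁅ v ⁆))

  RedLDNumber≡ : ℕ → Set
  RedLDNumber≡ k = (∃[ S ] (IsRedLD S × ∣ S ∣ ≡ k)) × (∀ S → IsRedLD S → k ≤ ∣ S ∣)

InTmax : {n : ℕ} → Graph n → Set
InTmax {n} G = IsTree G × 2 ≤ n × RedLDNumber≡ G n

delete : {m : ℕ} → Graph (suc m) → Fin (suc m) → Graph m
delete G v = record
  { adj   = λ i j → adj G (punchIn v i) (punchIn v j)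
  ; sym   = λ i j → sym G (punchIn v i) (punchIn v j)
  ; irref = λ i → irref G (punchIn v i) }

LeafCondition : {n : ℕ} → Graph n → Fin n → Set
LeafCondition G v =
  (IsLeaf G v × ∃[ s ] (Adj G v s × ∃[ l ] (l ≢ v × IsLeaf G l × Adj G s l)))
  Data.Sum.⊎
  (IsLeaf G v × ∃[ s ] (Adj G v s × degree G s ≡ 2))
  where import Data.Sum

{-# OPTIONS --safe #-}
-- A tree with at least two vertices lies in 𝒯_max exactly when every vertex is a leaf or a
-- support vertex. Indeed a RED:LD set must contain both ends of every pendant edge, while if x
-- is neither, V - {x} is already a RED:LD set: x and another vertex y could only fail to be
-- located by V - {x, y} if x, y and two neighbours of x formed a triangle or a 4-cycle.
-- If T - v is a tree then v is a leaf (two neighbours of v would close a cycle through T - v),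
-- and deleting a leaf v with support s only lowers the degree of s. So T - v stays in 𝒯_max
-- exactly when s is still a leaf (degree 2 in T) or still a support vertex (another leaf).
module Submission where

open import Defs hiding (sym)
open import Data.Nat as ℕ using (ℕ; zero; suc; _≤_; s≤s; z≤n)
open import Data.Nat.Properties using (suc-injective; 0≢1+n; <⇒≱)
open import Data.Bool using (Bool; true; false; T; T?)
open import Data.Fin using (Fin; zero; suc; punchIn; punchOut; _≟_)
open import Data.Fin.Properties
  using (any?; punchIn-punchOut; punchOut-punchIn; punchOut-cong; punchInᵢ≢i; punchIn-injective)
open import Data.Fin.Subset using (Subset; _⊆_; _∈_; _∉_; ∣_∣; _─_; _-_; ⁅_⁆; ⊤)
open import Data.Fin.Subset.Properties
  using (∈⊤; ∣⊤∣≡n; x∈⁅x⁆; x∈p∧x≢y⇒x∈p-y; x∈p⇒∣p-x∣<∣p∣; p─q⊆p; p⊆q⇒∣p∣≤∣q∣)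
  renaming (_∈?_ to _∈ₛ?_)
open import Data.Vec using (_∷_; tabulate; here; there)
open import Data.List using (List; []; _∷_; _++_; map; length)
open import Data.List.Properties using (length-map; map-++)
open import Data.List.Relation.Unary.All using (All; []; _∷_; universal)
import Data.List.Relation.Unary.All.Properties as All
open import Data.List.Relation.Unary.Any using (here; there)
open import Data.List.Relation.Unary.AllPairs using ([]; _∷_)
open import Data.List.Relation.Unary.Unique.Propositional using (Unique)
open import Data.List.Relation.Unary.Linked using (Linked; [-]; _∷_)
import Data.List.Relation.Unary.Linked.Properties as Linked
import Data.List.Relation.Unary.Unique.Propositional.Properties as Unique
open import Data.Product using (∃; ∃-syntax; _×_; _,_; proj₁; proj₂)
open import Data.Sum using (_⊎_; inj₁; inj₂)
open import Data.Empty using (⊥; ⊥-elim)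
open import Function using (id; _∘_; _⇔_; mk⇔; Equivalence)
open import Relation.Binary.Definitions using (DecidableEquality)
open import Relation.Binary.PropositionalEquality
  using (_≡_; _≢_; refl; sym; trans; cong; subst; subst₂; ≢-sym)
open import Relation.Binary.Construct.Closure.ReflexiveTransitive using (Star; ε; _◅_; kleisliStar)
open import Relation.Nullary using (¬_; Dec; yes; no; ¬?)
open import Relation.Nullary.Decidable using (_×-dec_; decidable-stable)

count : ∀ {n} → (Fin n → Bool) → ℕ
count f = ∣ tabulate f ∣

count-punchIn-T : ∀ {n} (f : Fin (suc n) → Bool) i → T (f i) → count f ≡ suc (count (f ∘ punchIn i))
count-punchIn-T f zero fi with f zero
... | true = refl
count-punchIn-T {suc n} f (suc i) fi with f zero
... | true  = cong suc (count-punchIn-T (f ∘ suc) i fi)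
... | false = count-punchIn-T (f ∘ suc) i fi

count-punchIn-¬T : ∀ {n} (f : Fin (suc n) → Bool) i → ¬ T (f i) → count f ≡ count (f ∘ punchIn i)
count-punchIn-¬T f zero ¬fi with f zero
... | false = refl
... | true  = ⊥-elim (¬fi _)
count-punchIn-¬T {suc n} f (suc i) ¬fi with f zero
... | true  = cong suc (count-punchIn-¬T (f ∘ suc) i ¬fi)
... | false = count-punchIn-¬T (f ∘ suc) i ¬fi

count≡0 : ∀ {n} (f : Fin n → Bool) → (∀ i → ¬ T (f i)) → count f ≡ 0
count≡0 {zero}  f none = refl
count≡0 {suc n} f none = trans (count-punchIn-¬T f zero (none zero)) (count≡0 (f ∘ suc) (none ∘ suc))

count≡0⇒¬T : ∀ {n} (f : Fin n → Bool) → count f ≡ 0 → ∀ i → ¬ T (f i)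
count≡0⇒¬T {suc n} f c i fi with () ← trans (sym c) (count-punchIn-T f i fi)

count≡1⇒unique : ∀ {n} (f : Fin n → Bool) → count f ≡ 1 → ∃[ i ] (T (f i) × ∀ j → T (f j) → j ≡ i)
count≡1⇒unique {zero}  f ()
count≡1⇒unique {suc n} f c with any? (T? ∘ f)
... | no none = ⊥-elim (0≢1+n (trans (sym (count≡0 f (λ i fi → none (i , fi)))) c))
... | yes (i , fi) = i , fi , only-i
  where
    rest≡0 : count (f ∘ punchIn i) ≡ 0
    rest≡0 = suc-injective (trans (sym (count-punchIn-T f i fi)) c)
    only-i : ∀ j → T (f j) → j ≡ i
    only-i j fj with i ≟ j
    ... | yes i≡j = sym i≡j
    ... | no  i≢j = ⊥-elim (count≡0⇒¬T (f ∘ punchIn i) rest≡0 (punchOut i≢j)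
                              (subst (T ∘ f) (sym (punchIn-punchOut i≢j)) fj))

unique⇒count≡1 : ∀ {n} (f : Fin n → Bool) i → T (f i) → (∀ j → T (f j) → j ≡ i) → count f ≡ 1
unique⇒count≡1 {suc n} f i fi only-i =
  trans (count-punchIn-T f i fi)
        (cong suc (count≡0 (f ∘ punchIn i) (λ j fj → punchInᵢ≢i i j (only-i _ fj))))

data Path {A : Set} (R : A → A → Set) : A → A → List A → Set where
  stop : ∀ {x} → Path R x x (x ∷ [])
  step : ∀ {x y z p} → R x y → Path R y z p → Path R x z (x ∷ p)

module _ {A : Set} {R : A → A → Set} where

  Path-map : ∀ {B : Set} {R′ : B → B → Set} (f : A → B) → (∀ {x y} → R x y → R′ (f x) (f y)) →
             ∀ {x y p} → Path R x y p → Path R′ (f x) (f y) (map f p)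
  Path-map f f-hom stop       = stop
  Path-map f f-hom (step r π) = step (f-hom r) (Path-map f f-hom π)

  Path-length≥2 : ∀ {x y p} → Path R x y p → x ≢ y → 2 ≤ length p
  Path-length≥2 stop                x≢y = ⊥-elim (x≢y refl)
  Path-length≥2 (step _ stop)       _   = s≤s (s≤s z≤n)
  Path-length≥2 (step _ (step _ _)) _   = s≤s (s≤s z≤n)

  Path-extend : ∀ {x y u w p} → Path R x y p → R u x → R y w → Linked R (u ∷ p ++ w ∷ [])
  Path-extend stop       ux yw = ux ∷ yw ∷ [-]
  Path-extend (step r π) ux yw = ux ∷ Path-extend π r yw

  module _ (_≟ₐ_ : DecidableEquality A) where
    open import Data.List.Membership.DecPropositional _≟ₐ_ renaming (_∈_ to _∈ₗ_; _∈?_ to _∈ₗ?_)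

    Path-suffix : ∀ {x y z p} → Path R y z p → Unique p → x ∈ₗ p → ∃[ q ] (Path R x z q × Unique q)
    Path-suffix stop         u       (here refl) = _ , stop , u
    Path-suffix π@(step _ _) u       (here refl) = _ , π , u
    Path-suffix (step _ π)   (_ ∷ u) (there x∈p) = Path-suffix π u x∈p

    -- loop erasure: if x recurs later on the path, restart the path there
    Star⇒simplePath : ∀ {x z} → Star R x z → ∃[ p ] (Path R x z p × Unique p)
    Star⇒simplePath {x} ε = x ∷ [] , stop , [] ∷ []
    Star⇒simplePath {x} (r ◅ rs) with Star⇒simplePath rs
    ... | p , π , u with x ∈ₗ? p
    ...   | yes x∈p = Path-suffix π u x∈p
    ...   | no  x∉p = x ∷ p , step r π , All.¬Any⇒All¬ p x∉p ∷ u

x∈p─q⇒x∉q : ∀ {n} {p q : Subset n} {x} → x ∈ p ─ q → x ∉ q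
x∈p─q⇒x∉q {p = _ ∷ _} {q = true  ∷ _} {zero}  ()
x∈p─q⇒x∉q {p = _ ∷ _} {q = false ∷ _} {zero}  _         ()
x∈p─q⇒x∉q {p = _ ∷ _} {q = _ ∷ _}     {suc x} (there m) (there m′) = x∈p─q⇒x∉q m m′

x∉p-x : ∀ {n} (p : Subset n) x → x ∉ p - x
x∉p-x p x x∈p-x = x∈p─q⇒x∉q x∈p-x (x∈⁅x⁆ x)

y∈⊤-x : ∀ {n} {x y : Fin n} → y ≢ x → y ∈ ⊤ - x
y∈⊤-x = x∈p∧x≢y⇒x∈p-y ∈⊤

y∉⊤-x⇒y≡x : ∀ {n} {x y : Fin n} → y ∉ ⊤ - x → y ≡ x
y∉⊤-x⇒y≡x {x = x} {y} y∉ = decidable-stable (y ≟ x) (y∉ ∘ y∈⊤-x)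

module _ {n : ℕ} (G : Graph n) where

  Adj-sym : ∀ {u w} → Adj G u w → Adj G w u
  Adj-sym {u} {w} = subst T (Graph.sym G u w)

  Adj-irrefl : ∀ {u} → ¬ Adj G u u
  Adj-irrefl {u} = subst T (irref G u)

  Adj⇒≢ : ∀ {u w} → Adj G u w → u ≢ w
  Adj⇒≢ uw refl = Adj-irrefl uw

  Adj? : ∀ u w → Dec (Adj G u w)
  Adj? u w = T? (adj G u w)

  IsLeaf? : ∀ u → Dec (IsLeaf G u)
  IsLeaf? u = degree G u ℕ.≟ 1

  leaf⇒sole-neighbour : ∀ {u} → IsLeaf G u → ∃[ s ] (Adj G u s × ∀ z → Adj G u z → z ≡ s)
  leaf⇒sole-neighbour = count≡1⇒unique (adj G _)

  sole-neighbour⇒leaf : ∀ {u s} → Adj G u s → (∀ z → Adj G u z → z ≡ s) → IsLeaf G u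
  sole-neighbour⇒leaf = unique⇒count≡1 (adj G _) _

  leaf-neighbours-equal : ∀ {u a b} → IsLeaf G u → Adj G u a → Adj G u b → a ≡ b
  leaf-neighbours-equal leaf ua ub with leaf⇒sole-neighbour leaf
  ... | _ , _ , only-s = trans (only-s _ ua) (sym (only-s _ ub))

  neighbour-other-than? : ∀ u x → (∃[ z ] (Adj G u z × z ≢ x)) ⊎ (∀ z → Adj G u z → z ≡ x)
  neighbour-other-than? u x with any? (λ z → Adj? u z ×-dec ¬? (z ≟ x))
  ... | yes (z , uz , z≢x) = inj₁ (z , uz , z≢x)
  ... | no none            = inj₂ λ z uz → decidable-stable (z ≟ x) (λ z≢x → none (z , uz , z≢x))

  neighbour-other-than : ∀ {x a b} → Adj G x a → Adj G x b → a ≢ b → ∀ y → ∃[ c ] (Adj G x c × c ≢ y)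
  neighbour-other-than {a = a} {b} xa xb a≢b y with a ≟ y
  ... | yes refl = b , xb , ≢-sym a≢b
  ... | no  a≢y  = a , xa , a≢y

  connected⇒neighbour : Connected G → 2 ≤ n → ∀ x → ∃ (Adj G x)
  connected⇒neighbour conn 2≤n x = first-step (conn x (another 2≤n x)) (another≢ 2≤n x)
    where
      another : 2 ≤ n → Fin n → Fin n
      another (s≤s (s≤s _)) zero    = suc zero
      another (s≤s (s≤s _)) (suc _) = zero
      another≢ : ∀ 2≤n x → another 2≤n x ≢ x
      another≢ (s≤s (s≤s _)) zero    ()
      another≢ (s≤s (s≤s _)) (suc _) ()
      first-step : ∀ {y} → Star (Adj G) x y → y ≢ x → ∃ (Adj G x)
      first-step ε         y≢x = ⊥-elim (y≢x refl)
      first-step (xz ◅ _)  _   = _ , xz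

  IsSupport : Fin n → Set
  IsSupport x = ∃[ l ] (Adj G x l × IsLeaf G l)

  LeafOrSupport : Fin n → Set
  LeafOrSupport x = IsLeaf G x ⊎ IsSupport x

  leafOrSupport⇒neighbour : ∀ {x} → LeafOrSupport x → ∃ (Adj G x)
  leafOrSupport⇒neighbour (inj₁ leaf)           = _ , proj₁ (proj₂ (leaf⇒sole-neighbour leaf))
  leafOrSupport⇒neighbour (inj₂ (_ , xl , _))  = _ , xl

  triangle-cycle : ∀ {x y z} → Adj G x y → Adj G y z → Adj G z x → IsCycle G (x ∷ y ∷ z ∷ [])
  triangle-cycle xy yz zx =
    s≤s (s≤s (s≤s z≤n)) ,
    (Adj⇒≢ xy ∷ ≢-sym (Adj⇒≢ zx) ∷ []) ∷ (Adj⇒≢ yz ∷ []) ∷ [] ∷ [] ,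
    xy ∷ yz ∷ zx ∷ [-]

  square-cycle : ∀ {x a y b} → x ≢ y → a ≢ b →
                 Adj G x a → Adj G a y → Adj G y b → Adj G b x → IsCycle G (x ∷ a ∷ y ∷ b ∷ [])
  square-cycle x≢y a≢b xa ay yb bx =
    s≤s (s≤s (s≤s z≤n)) ,
    (Adj⇒≢ xa ∷ x≢y ∷ ≢-sym (Adj⇒≢ bx) ∷ []) ∷ (Adj⇒≢ ay ∷ a≢b ∷ []) ∷ (Adj⇒≢ yb ∷ []) ∷ [] ∷ [] ,
    xa ∷ ay ∷ yb ∷ bx ∷ [-]

  path-cycle : ∀ {a b u p} → Path (Adj G) a b p → Unique p → a ≢ b → All (u ≢_) p →
               Adj G u a → Adj G b u → IsCycle G (u ∷ p)
  path-cycle π uniq a≢b u∉p ua bu =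
    s≤s (Path-length≥2 π a≢b) , u∉p ∷ uniq , Path-extend π ua bu

  -- otherwise x, y and two neighbours of x span a triangle (if x ∼ y) or a 4-cycle
  no-twin : Acyclic G → ∀ {x y a b} → Adj G x a → Adj G x b → a ≢ b → y ≢ x →
            (∀ z → z ≢ x → z ≢ y → Adj G x z → Adj G y z) → ⊥
  no-twin acyclic {x} {y} {a} {b} xa xb a≢b y≢x x⊆y with Adj? x y
  ... | yes xy =
    let (c , xc , c≢y) = neighbour-other-than xa xb a≢b y
    in  acyclic _ (triangle-cycle xy (x⊆y c (≢-sym (Adj⇒≢ xc)) c≢y xc) (Adj-sym xc))
  ... | no ¬xy = acyclic _ (square-cycle (≢-sym y≢x) a≢b xa (Adj-sym (y∼ xa)) (y∼ xb) (Adj-sym xb))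
    where
      y∼ : ∀ {c} → Adj G x c → Adj G y c
      y∼ {c} xc = x⊆y c (≢-sym (Adj⇒≢ xc)) (λ { refl → ¬xy xc }) xc

  sole-neighbour∈LD : ∀ {S p q} → IsLD G S → p ∉ S → (∀ z → Adj G p z → z ≡ q) → q ∈ S
  sole-neighbour∈LD {S} ld p∉S only-q with proj₁ (ld _ _ p∉S p∉S)
  ... | z , z∈S , pz = subst (_∈ S) (only-q z pz) z∈S

  pendant⊆RedLD : ∀ {S p q} → IsRedLD G S → (∀ z → Adj G p z → z ≡ q) → p ∈ S × q ∈ S
  pendant⊆RedLD {S} {p} {q} (ld , ld-v) only-q = p∈S , q∈S
    where
      p∈S : p ∈ S
      p∈S = decidable-stable (p ∈ₛ? S) λ p∉S → case (q ∈ₛ? S) p∉S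
        where
          case : Dec (q ∈ S) → p ∉ S → ⊥
          case (yes q∈S) p∉S =
            x∉p-x S q (sole-neighbour∈LD (ld-v q q∈S) (p∉S ∘ p─q⊆p S ⁅ q ⁆) only-q)
          case (no q∉S)  p∉S = q∉S (sole-neighbour∈LD ld p∉S only-q)
      q∈S : q ∈ S
      q∈S = decidable-stable (q ∈ₛ? S) λ q∉S →
        q∉S (p─q⊆p S ⁅ p ⁆ (sole-neighbour∈LD (ld-v p p∈S) (x∉p-x S p) only-q))

  leafOrSupport⇒⊤⊆RedLD : (∀ x → LeafOrSupport x) → ∀ {S} → IsRedLD G S → ⊤ ⊆ S
  leafOrSupport⇒⊤⊆RedLD ls red {x} _ with ls x
  ... | inj₁ leaf =
    let (_ , _ , only-s) = leaf⇒sole-neighbour leaf in proj₁ (pendant⊆RedLD red only-s)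
  ... | inj₂ (l , xl , l-leaf) =
    proj₂ (pendant⊆RedLD red λ z lz → leaf-neighbours-equal l-leaf lz (Adj-sym xl))

  ⊤-isRedLD : (∀ x → ∃ (Adj G x)) → IsRedLD G ⊤
  ⊤-isRedLD neighbour = (λ u _ u∉⊤ _ → ⊥-elim (u∉⊤ ∈⊤)) , ⊤-v-isLD
    where
      ⊤-v-isLD : ∀ v → v ∈ ⊤ → IsLD G (⊤ - v)
      ⊤-v-isLD v _ u w u∉ w∉ with y∉⊤-x⇒y≡x u∉ | y∉⊤-x⇒y≡x w∉
      ... | refl | refl =
        let (y , vy) = neighbour v in (y , y∈⊤-x (≢-sym (Adj⇒≢ vy)) , vy) , λ v≢v _ → v≢v refl

  leafOrSupport⇒RedLDNumber≡n : (∀ x → LeafOrSupport x) → RedLDNumber≡ G n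
  leafOrSupport⇒RedLDNumber≡n ls =
    (⊤ , ⊤-isRedLD (leafOrSupport⇒neighbour ∘ ls) , ∣⊤∣≡n n) ,
    λ S red → subst (_≤ ∣ S ∣) (∣⊤∣≡n n) (p⊆q⇒∣p∣≤∣q∣ (leafOrSupport⇒⊤⊆RedLD ls red))

  module _ (acyclic : Acyclic G) (neighbour : ∀ x → ∃ (Adj G x)) where

    ⊤-x-isRedLD : ∀ {x a b} → Adj G x a → Adj G x b → a ≢ b → (∀ l → Adj G x l → ¬ IsLeaf G l) →
                  IsRedLD G (⊤ - x)
    ⊤-x-isRedLD {x} {a} {b} xa xb a≢b no-leaf = ⊤-x-isLD , ⊤-x-y-isLD
      where
        ⊤-x-isLD : IsLD G (⊤ - x)
        ⊤-x-isLD u w u∉ w∉ with y∉⊤-x⇒y≡x u∉ | y∉⊤-x⇒y≡x w∉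
        ... | refl | refl = (a , y∈⊤-x (≢-sym (Adj⇒≢ xa)) , xa) , λ x≢x _ → x≢x refl

        outside : ∀ {y z} → z ∉ ⊤ - x - y → z ≡ x ⊎ z ≡ y
        outside {y} {z} z∉ with z ≟ y
        ... | yes z≡y = inj₂ z≡y
        ... | no  z≢y = inj₁ (y∉⊤-x⇒y≡x (z∉ ∘ λ z∈⊤-x → x∈p∧x≢y⇒x∈p-y z∈⊤-x z≢y))

        inside : ∀ {y z} → z ≢ x → z ≢ y → z ∈ ⊤ - x - y
        inside z≢x z≢y = x∈p∧x≢y⇒x∈p-y (y∈⊤-x z≢x) z≢y

        dominated : ∀ y → y ≢ x → ∀ {w} → w ≡ x ⊎ w ≡ y → ∃[ z ] (z ∈ ⊤ - x - y × Adj G w z)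
        dominated y _ (inj₁ refl) =
          let (c , xc , c≢y) = neighbour-other-than xa xb a≢b y
          in  c , inside (≢-sym (Adj⇒≢ xc)) c≢y , xc
        dominated y _ (inj₂ refl) with neighbour-other-than? y x
        ... | inj₁ (z , yz , z≢x) = z , inside z≢x (≢-sym (Adj⇒≢ yz)) , yz
        ... | inj₂ only-x =
          let (z , yz) = neighbour y
              yx = subst (Adj G y) (only-x z yz) yz
          in  ⊥-elim (no-leaf y (Adj-sym yx) (sole-neighbour⇒leaf yx only-x))

        located : ∀ y → y ≢ x → ∀ {u w} → u ≡ x ⊎ u ≡ y → w ≡ x ⊎ w ≡ y → u ≢ w →
                  ¬ (∀ z → z ∈ ⊤ - x - y → (Adj G w z ⇔ Adj G u z))
        located y y≢x (inj₁ refl) (inj₁ refl) x≢x _ = x≢x refl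
        located y y≢x (inj₂ refl) (inj₂ refl) y≢y _ = y≢y refl
        located y y≢x (inj₁ refl) (inj₂ refl) _ same =
          no-twin acyclic xa xb a≢b y≢x λ z z≢x z≢y → Equivalence.from (same z (inside z≢x z≢y))
        located y y≢x (inj₂ refl) (inj₁ refl) _ same =
          no-twin acyclic xa xb a≢b y≢x λ z z≢x z≢y → Equivalence.to (same z (inside z≢x z≢y))

        ⊤-x-y-isLD : ∀ y → y ∈ ⊤ - x → IsLD G (⊤ - x - y)
        ⊤-x-y-isLD y y∈ u w u∉ w∉ =
          dominated y y≢x (outside w∉) , located y y≢x (outside u∉) (outside w∉)
          where
            y≢x : y ≢ x
            y≢x refl = x∉p-x ⊤ y y∈

    RedLDNumber≡n⇒leafOrSupport : RedLDNumber≡ G n → ∀ x → LeafOrSupport x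
    RedLDNumber≡n⇒leafOrSupport (_ , minimal) x with neighbour x
    ... | a , xa with neighbour-other-than? x a
    ...   | inj₂ only-a = inj₁ (sole-neighbour⇒leaf xa only-a)
    ...   | inj₁ (b , xb , b≢a) with any? (λ l → Adj? x l ×-dec IsLeaf? l)
    ...     | yes support = inj₂ support
    ...     | no ¬support = ⊥-elim (<⇒≱ ∣⊤-x∣<n (minimal (⊤ - x) ⊤-x-red))
      where
        ⊤-x-red : IsRedLD G (⊤ - x)
        ⊤-x-red = ⊤-x-isRedLD xa xb (≢-sym b≢a) λ l xl l-leaf → ¬support (l , xl , l-leaf)
        ∣⊤-x∣<n : ∣ ⊤ - x ∣ ℕ.< n
        ∣⊤-x∣<n = subst (∣ ⊤ - x ∣ ℕ.<_) (∣⊤∣≡n n) (x∈p⇒∣p-x∣<∣p∣ {p = ⊤} (∈⊤ {x = x}))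

InTmax⇒leafOrSupport : ∀ {n} {G : Graph n} → InTmax G → ∀ x → LeafOrSupport G x
InTmax⇒leafOrSupport {G = G} ((conn , acyclic) , 2≤n , rednum) =
  RedLDNumber≡n⇒leafOrSupport G acyclic (connected⇒neighbour G conn 2≤n) rednum

data PunchInView {m : ℕ} (v : Fin (suc m)) : Fin (suc m) → Set where
  deleted : PunchInView v v
  kept    : ∀ x → PunchInView v (punchIn v x)

punchIn-view : ∀ {m} (v u : Fin (suc m)) → PunchInView v u
punchIn-view v u with v ≟ u
... | yes refl = deleted
... | no  v≢u  = subst (PunchInView v) (punchIn-punchOut v≢u) (kept (punchOut v≢u))

punchOut-≡ : ∀ {m} {v w : Fin (suc m)} {x} (v≢w : v ≢ w) → w ≡ punchIn v x → punchOut v≢w ≡ x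
punchOut-≡ {v = v} _ w≡vx = trans (punchOut-cong v w≡vx) (punchOut-punchIn v)

module _ {m : ℕ} (G : Graph (suc m)) (v : Fin (suc m)) where

  degree-delete-adj : ∀ x → Adj G (punchIn v x) v → degree G (punchIn v x) ≡ suc (degree (delete G v) x)
  degree-delete-adj x = count-punchIn-T (adj G (punchIn v x)) v

  degree-delete-nonadj : ∀ x → ¬ Adj G (punchIn v x) v → degree G (punchIn v x) ≡ degree (delete G v) x
  degree-delete-nonadj x = count-punchIn-¬T (adj G (punchIn v x)) v

  delete-leafOrSupport : ∀ x → ¬ Adj G (punchIn v x) v →
                         LeafOrSupport G (punchIn v x) → LeafOrSupport (delete G v) x
  delete-leafOrSupport x x≁v (inj₁ leaf) = inj₁ (trans (sym (degree-delete-nonadj x x≁v)) leaf)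
  delete-leafOrSupport x x≁v (inj₂ (l , xl , l-leaf)) with punchIn-view v l
  ... | deleted = ⊥-elim (x≁v xl)
  ... | kept l′ = inj₂ (l′ , xl , trans (sym (degree-delete-nonadj l′ l′≁v)) l-leaf)
    where
      l′≁v : ¬ Adj G (punchIn v l′) v
      l′≁v l′v = punchInᵢ≢i v x (sym (leaf-neighbours-equal G l-leaf l′v (Adj-sym G xl)))

  delete-acyclic : Acyclic G → Acyclic (delete G v)
  delete-acyclic acyclic (x ∷ xs) (3≤ , uniq , linked) =
    acyclic (map (punchIn v) (x ∷ xs))
      ( subst (3 ≤_) (sym (length-map (punchIn v) (x ∷ xs))) 3≤
      , Unique.map⁺ (punchIn-injective v _ _) uniq
      , subst (Linked (Adj G)) (map-++ (punchIn v) (x ∷ xs) (x ∷ [])) (Linked.map⁺ linked))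

  delete-connected⇒neighbours-equal : Acyclic G → Connected (delete G v) →
                                      ∀ {a b} → Adj G v a → Adj G v b → a ≡ b
  delete-connected⇒neighbours-equal acyclic conn {a} {b} va vb
    with punchIn-view v a | punchIn-view v b
  ... | deleted | _       = ⊥-elim (Adj-irrefl G va)
  ... | kept _  | deleted = ⊥-elim (Adj-irrefl G vb)
  ... | kept a′ | kept b′ with a′ ≟ b′
  ...   | yes refl = refl
  ...   | no  a′≢b′ =
    let (p , π , uniq) = Star⇒simplePath _≟_ (conn a′ b′)
    in  ⊥-elim (acyclic (v ∷ map (punchIn v) p)
          (path-cycle G (Path-map (punchIn v) id π)
             (Unique.map⁺ (punchIn-injective v _ _) uniq)
             (a′≢b′ ∘ punchIn-injective v a′ b′)
             (All.map⁺ (universal (λ x → ≢-sym (punchInᵢ≢i v x)) p))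
             va (Adj-sym G vb)))

  -- every walk in G retracts onto G - v by sending the leaf v to its neighbour
  delete-leaf-connected : Connected G → IsLeaf G v → Connected (delete G v)
  delete-leaf-connected conn leaf i j with leaf⇒sole-neighbour G leaf
  ... | s , vs , only-s with punchIn-view v s
  ...   | deleted = ⊥-elim (Adj-irrefl G vs)
  ...   | kept s′ =
    subst₂ (Star (Adj (delete G v))) (retract-punchIn i) (retract-punchIn j)
      (kleisliStar retract retract-edge (conn (punchIn v i) (punchIn v j)))
    where
      retract : Fin (suc m) → Fin m
      retract u with v ≟ u
      ... | yes _   = s′
      ... | no  v≢u = punchOut v≢u

      retract-punchIn : ∀ x → retract (punchIn v x) ≡ x
      retract-punchIn x with v ≟ punchIn v x
      ... | yes v≡x = ⊥-elim (punchInᵢ≢i v x (sym v≡x))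
      ... | no  v≢x = punchOut-≡ v≢x refl

      retract-edge : ∀ {u w} → Adj G u w → Star (Adj (delete G v)) (retract u) (retract w)
      retract-edge {u} {w} uw with v ≟ u | v ≟ w
      ... | yes refl | yes refl = ⊥-elim (Adj-irrefl G uw)
      ... | yes refl | no  v≢w  = subst (Star _ s′) (sym (punchOut-≡ v≢w (only-s w uw))) ε
      ... | no  v≢u  | yes refl =
        subst (λ t → Star _ t s′) (sym (punchOut-≡ v≢u (only-s u (Adj-sym G uw)))) ε
      ... | no  v≢u  | no  v≢w  =
        subst₂ (Adj G) (sym (punchIn-punchOut v≢u)) (sym (punchIn-punchOut v≢w)) uw ◅ ε

leafCondition⇒leaf : ∀ {n} (G : Graph n) {v} → LeafCondition G v → IsLeaf G v
leafCondition⇒leaf _ (inj₁ (leaf , _)) = leaf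
leafCondition⇒leaf _ (inj₂ (leaf , _)) = leaf

module _ {m : ℕ} (T : Graph (suc m)) (v : Fin (suc m)) (T∈Tmax : InTmax T) where

  private
    conn : Connected T
    conn = proj₁ (proj₁ T∈Tmax)

    acyclic : Acyclic T
    acyclic = proj₂ (proj₁ T∈Tmax)

  delete∈Tmax⇒leafCondition : InTmax (delete T v) → LeafCondition T v
  delete∈Tmax⇒leafCondition T′∈Tmax
    with connected⇒neighbour T conn (proj₁ (proj₂ T∈Tmax)) v
  ... | s , vs with punchIn-view v s
  ...   | deleted = ⊥-elim (Adj-irrefl T vs)
  ...   | kept s′ = from-support (InTmax⇒leafOrSupport T′∈Tmax s′)
    where
      only-s : ∀ z → Adj T v z → z ≡ punchIn v s′
      only-s z vz = delete-connected⇒neighbours-equal T v acyclic (proj₁ (proj₁ T′∈Tmax)) vz vs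

      v-leaf : IsLeaf T v
      v-leaf = sole-neighbour⇒leaf T vs only-s

      from-support : LeafOrSupport (delete T v) s′ → LeafCondition T v
      from-support (inj₁ s′-leaf) =
        inj₂ (v-leaf , _ , vs , trans (degree-delete-adj T v s′ (Adj-sym T vs)) (cong suc s′-leaf))
      from-support (inj₂ (l′ , s′l′ , l′-leaf)) =
        inj₁ (v-leaf , _ , vs , punchIn v l′ , punchInᵢ≢i v l′ ,
              trans (degree-delete-nonadj T v l′ l′≁v) l′-leaf , s′l′)
        where
          l′≁v : ¬ Adj T (punchIn v l′) v
          l′≁v l′v = Adj-irrefl (delete T v)
            (subst (Adj (delete T v) s′) (punchIn-injective v _ _ (only-s _ (Adj-sym T l′v))) s′l′)

  leafCondition⇒delete∈Tmax : 3 ≤ suc m → LeafCondition T v → InTmax (delete T v)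
  leafCondition⇒delete∈Tmax 3≤ cond with leaf⇒sole-neighbour T (leafCondition⇒leaf T cond)
  ... | s , vs , only-s with punchIn-view v s
  ...   | deleted = ⊥-elim (Adj-irrefl T vs)
  ...   | kept s′ =
    ( delete-leaf-connected T v conn (leafCondition⇒leaf T cond) , delete-acyclic T v acyclic)
    , ℕ.s≤s⁻¹ 3≤
    , leafOrSupport⇒RedLDNumber≡n (delete T v) leafOrSupport
    where
      ≁v : ∀ {x′} → x′ ≢ s′ → ¬ Adj T (punchIn v x′) v
      ≁v x′≢s′ x′v = x′≢s′ (punchIn-injective v _ _ (only-s _ (Adj-sym T x′v)))

      s′-leafOrSupport : LeafCondition T v → LeafOrSupport (delete T v) s′
      s′-leafOrSupport (inj₁ (_ , s₀ , vs₀ , l , l≢v , l-leaf , s₀l)) with punchIn-view v l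
      ... | deleted = ⊥-elim (l≢v refl)
      ... | kept l′ = inj₂ (l′ , s′l′ , trans (sym (degree-delete-nonadj T v l′ (≁v l′≢s′))) l-leaf)
        where
          s′l′ : Adj T (punchIn v s′) (punchIn v l′)
          s′l′ = subst (λ t → Adj T t (punchIn v l′)) (only-s s₀ vs₀) s₀l
          l′≢s′ : l′ ≢ s′
          l′≢s′ refl = Adj-irrefl T s′l′
      s′-leafOrSupport (inj₂ (_ , s₀ , vs₀ , degree≡2)) =
        inj₁ (suc-injective (trans (sym (degree-delete-adj T v s′ (Adj-sym T vs)))
                                   (subst (λ t → degree T t ≡ 2) (only-s s₀ vs₀) degree≡2)))

      leafOrSupport : ∀ x′ → LeafOrSupport (delete T v) x′
      leafOrSupport x′ with x′ ≟ s′
      ... | yes refl  = s′-leafOrSupport cond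
      ... | no  x′≢s′ =
        delete-leafOrSupport T v x′ (≁v x′≢s′) (InTmax⇒leafOrSupport T∈Tmax (punchIn v x′))

theorem11 : ∀ (m : ℕ) (T : Graph (suc m)) → InTmax T → 3 ≤ suc m →
    (v : Fin (suc m)) → (InTmax (delete T v) ⇔ LeafCondition T v)
theorem11 m T T∈Tmax 3≤n v =
  mk⇔ (delete∈Tmax⇒leafCondition T v T∈Tmax) (leafCondition⇒delete∈Tmax T v T∈Tmax 3≤n)
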